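{- Let $A=[a_{i,j}]_{1\le i,j\le 2n}$ be a $2n\times 2n$ real matrix, let $U_n$ be the $n\times n$ all-ones matrix and $\tilde U_{2n}=\begin{bmatrix}U_n&-U_n\\-U_n&U_n\end{bmatrix}$. Let $S=\{(i,j)\in[2n]\times[2n]: i+j\in[n+1,2n]\cup[3n+2,4n]\}$. Then applying $\phi_{k,l}$ for all $(k,l)\in S$ (in any order) to $A$ yields $A\circ\tilde U_{2n}$. Consequently $\mathrm{per}(A)=\mathrm{per}(A\circ\tilde U_{2n})$.
   Context: For $1\le k,l\le 2n$, $\phi_{k,l}(A)$ is the matrix obtained from $A$ by multiplying the $k$-th row by $-1$ and the $l$-th column by $-1$ (so the $(k,l)$ entry is unchanged); these maps commute. For same-size matrices, the Hadamard product is $A\circ B=[a_{i,j}b_{i,j}]$. $[a,b]=\{a,\dots,b\}$. $\mathrm{per}[a_{i,j}]_{1\le i,j\le N}=\sum_{\pi\in\mathfrak S_N}\prod_i a_{i,\pi(i)}$. -}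

module Defs where

open import Level using (_⊔_)
open import Algebra.Bundles using (CommutativeRing)
open import Data.Nat as ℕ using (ℕ; zero; suc)
open import Data.Fin as Fin using (Fin; toℕ)
open import Data.Fin.Properties using (_≟_)
open import Data.Bool using (Bool; true; false; _∧_; _xor_; if_then_else_)
open import Data.List using (List; []; _∷_; foldr; map; concatMap; filter; allFin)
open import Data.List.Relation.Unary.All using (All)
open import Data.Product using (_×_; _,_)
open import Data.Sum using (_⊎_)
open import Relation.Nullary using (does)
open import Relation.Binary.PropositionalEquality using (_≡_)
import Data.Vec.Functional as VF

module _ {c ℓ} (R : CommutativeRing c ℓ) where
  open CommutativeRing R

  Matrix : ℕ → Set c
  Matrix N = Fin N → Fin N → Carrier

  _≋_ : ∀ {N} → Matrix N → Matrix N → Set ℓ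
  A ≋ B = ∀ i j → A i j ≈ B i j

  negIf : Bool → Carrier → Carrier
  negIf b x = if b then - x else x

  φ : ∀ {N} → Fin N → Fin N → Matrix N → Matrix N
  φ k l A i j = negIf (does (i ≟ k)) (negIf (does (j ≟ l)) (A i j))

  applyAll : ∀ {N} → List (Fin N × Fin N) → Matrix N → Matrix N
  applyAll L A = foldr (λ { (k , l) B → φ k l B }) A L

  _∘ₕ_ : ∀ {N} → Matrix N → Matrix N → Matrix N
  (A ∘ₕ B) i j = A i j * B i j

  -- Ũ_{2n} = [[U_n, -U_n], [-U_n, U_n]] as a (n+n)×(n+n) matrix
  Ũ : (n : ℕ) → Matrix (n ℕ.+ n)
  Ũ n i j = if does (toℕ i ℕ.<? n) xor does (toℕ j ℕ.<? n) then - 1# else 1#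

  sumL : List Carrier → Carrier
  sumL = foldr _+_ 0#

  prodFin : ∀ N → (Fin N → Carrier) → Carrier
  prodFin N f = foldr _*_ 1# (map f (allFin N))

allFuns : ∀ m k → List (Fin m → Fin k)
allFuns zero k = (λ ()) ∷ []
allFuns (suc m) k = concatMap (λ f → map (λ x → x VF.∷ f) (allFin k)) (allFuns m k)

isInjective : ∀ {N} → (Fin N → Fin N) → Bool
isInjective {N} f = foldr _∧_ true
  (concatMap (λ i → map (λ j → if does (f i ≟ f j) then does (i ≟ j) else true) (allFin N)) (allFin N))

-- the symmetric group 𝔖_N, as the list of all bijections Fin N → Fin N
-- (an injective self-map of a finite set is a bijection)
perms : ∀ N → List (Fin N → Fin N)
perms N = filter (λ f → Data.Bool._≟_ (isInjective f) true) (allFuns N N)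

module _ {c ℓ} (R : CommutativeRing c ℓ) where
  open CommutativeRing R

  per : ∀ {N} → Matrix R N → Carrier
  per {N} A = sumL R (map (λ π → prodFin R N (λ i → A i (π i))) (perms N))

-- The index set S (paper's 1-based indices i+1, j+1):
-- (i+1)+(j+1) ∈ [n+1, 2n] ∪ [3n+2, 4n]
S : (n : ℕ) → Fin (n ℕ.+ n) × Fin (n ℕ.+ n) → Set
S n (i , j) = let s = toℕ i ℕ.+ toℕ j ℕ.+ 2 in
  (n ℕ.+ 1 ℕ.≤ s × s ℕ.≤ 2 ℕ.* n) ⊎ (3 ℕ.* n ℕ.+ 2 ℕ.≤ s × s ℕ.≤ 4 ℕ.* n)

{-# OPTIONS --safe #-}
-- Applying φ_{k,l} for all (k,l) of a list negates entry (i,j) once for every pair with k = i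
-- and once for every pair with l = j; for the list S this multiplies a_{i,j} by (-1)^(r_i + r_j),
-- where r_i is the number of entries of S in row i (S is symmetric, so r_j also counts column j).
-- Row i meets the 2n consecutive index sums starting at i: row 0 meets n of them in S, and
-- sliding the window by one changes the parity only as its start moves from n - 1 to n.  Hence
-- r_i ≡ n + [i ≥ n] (mod 2), and the sign is the entry of Ũ_{2n}.  Each φ_{k,l} negates a term
-- of the permanent twice, through row k and through column l, so the permanent is unchanged.
module Submission where

open import Defs
open import Algebra.Bundles using (CommutativeRing)
import Algebra.Properties.Ring as RingProperties
import Algebra.Properties.Semiring.Sum as SemiringSum
open import Data.Bool as Bool using (Bool; true; false; not; _∧_; _xor_; if_then_else_)
open import Data.Bool.Properties
  using (xor-∧-commutativeRing; xor-assoc; xor-comm; xor-same; xor-identityʳ; xor-annihilates-not;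
         ∧-comm; ∧-identityʳ; ∧-distribˡ-xor)
open import Data.Empty using (⊥-elim)
open import Data.Fin as Fin using (Fin; toℕ; punchOut)
open import Data.Fin.Properties using (_≟_; toℕ<n; any?; punchOut-injective; injective⇒≤)
open import Data.List using (List; []; _∷_; _++_; foldr; map; filter; tabulate; allFin; cartesianProduct)
open import Data.List.Properties using (map-tabulate; map-∘)
open import Data.List.Membership.Propositional using (_∈_)
open import Data.List.Membership.Propositional.Properties
  using (∈-filter⁺; ∈-filter⁻; ∈-cartesianProduct⁺; ∈-allFin; ∈-map⁺; ∈-concat⁺′)
open import Data.List.Membership.Propositional.Properties.WithK using (unique∧set⇒bag)
open import Data.List.Relation.Binary.BagAndSetEquality using (∼bag⇒↭)
open import Data.List.Relation.Binary.Permutation.Propositional using (_↭_; ↭⇒↭ₛ)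
open import Data.List.Relation.Binary.Permutation.Propositional.Properties using (map⁺)
import Data.List.Relation.Binary.Permutation.Setoid.Properties as ↭ₛ
open import Data.List.Relation.Unary.Any using (here; there)
open import Data.List.Relation.Unary.Unique.Propositional using (Unique)
import Data.List.Relation.Unary.Unique.Propositional.Properties as Unique
open import Data.Nat as ℕ using (ℕ; zero; suc; _+_; _≤_; _<_; _≤?_; _<?_; s≤s)
open import Data.Nat.Properties
  using (≤-trans; ≤-reflexive; <-trans; <⇒≱; ≮⇒≥; m+1+n≰m; n<1+n; m≤n⇒m≤1+n;
         m≤m+n; m≤n+m; +-comm; +-suc; +-identityʳ; +-mono-≤; +-monoˡ-≤; +-monoʳ-≤; <-irrefl)
open import Data.Nat.Tactic.RingSolver using (solve-∀)
open import Data.Product using (_×_; _,_; proj₂; ∃)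
open import Data.Sum using (_⊎_; inj₁; inj₂)
open import Function using (_∘_)
open import Function.Bundles using (_⇔_; mk⇔; Equivalence)
open import Function.Definitions using (Injective)
open import Relation.Nullary using (Dec; does; yes; no)
open import Relation.Nullary.Decidable using (dec-true; dec-false; _×-dec_; _⊎-dec_)
open import Relation.Unary using (Decidable)
open import Relation.Binary.PropositionalEquality as ≡
  using (_≡_; _≢_; refl; sym; trans; cong; cong₂; module ≡-Reasoning)

-- Parities, as sums in the Boolean ring (Bool, xor, ∧)

open SemiringSum (CommutativeRing.semiring xor-∧-commutativeRing)
  using (sum-cong-≗; sum-replicate-zero; ∑-distrib-+; *-distribˡ-sum)
  renaming (sum to parityFin)

xor-cancelʳ-both : ∀ x y z → (x xor z) xor (y xor z) ≡ x xor y
xor-cancelʳ-both x y z = begin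
  (x xor z) xor (y xor z)  ≡⟨ xor-assoc x z _ ⟩
  x xor (z xor (y xor z))  ≡⟨ cong (λ w → x xor (z xor w)) (xor-comm y z) ⟩
  x xor (z xor (z xor y))  ≡⟨ cong (x xor_) (sym (xor-assoc z z y)) ⟩
  x xor ((z xor z) xor y)  ≡⟨ cong (λ w → x xor (w xor y)) (xor-same z) ⟩
  x xor y                  ∎
  where open ≡-Reasoning

xor-cancel-outer : ∀ x z → (x xor z) xor x ≡ z
xor-cancel-outer false z     = xor-identityʳ z
xor-cancel-outer true  false = refl
xor-cancel-outer true  true  = refl

parity : ∀ {a} {A : Set a} → (A → Bool) → List A → Bool
parity c xs = foldr _xor_ false (map c xs)

parity-↭ : ∀ {a} {A : Set a} (c : A → Bool) {xs ys : List A} → xs ↭ ys → parity c xs ≡ parity c ys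
parity-↭ c xs↭ys = ↭ₛ.foldr-commMonoid (≡.setoid Bool)
  (CommutativeRing.+-isCommutativeMonoid xor-∧-commutativeRing) (↭⇒↭ₛ (map⁺ c xs↭ys))

parity-++ : ∀ {a} {A : Set a} (c : A → Bool) (xs ys : List A) →
            parity c (xs ++ ys) ≡ parity c xs xor parity c ys
parity-++ c []       ys = refl
parity-++ c (x ∷ xs) ys = trans (cong (c x xor_) (parity-++ c xs ys)) (sym (xor-assoc (c x) _ _))

parity-map : ∀ {a b} {A : Set a} {B : Set b} (c : B → Bool) (f : A → B) (xs : List A) →
             parity c (map f xs) ≡ parity (c ∘ f) xs
parity-map c f xs = cong (foldr _xor_ false) (sym (map-∘ xs))

parity-filter : ∀ {a p} {A : Set a} {P : A → Set p} (P? : Decidable P) (c : A → Bool) (xs : List A) →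
                parity c (filter P? xs) ≡ parity (λ x → does (P? x) ∧ c x) xs
parity-filter P? c []       = refl
parity-filter P? c (x ∷ xs) with does (P? x)
... | true  = cong (c x xor_) (parity-filter P? c xs)
... | false = parity-filter P? c xs

parity-cartesianProduct : ∀ {a b} {A : Set a} {B : Set b} (c : A × B → Bool) xs ys →
  parity c (cartesianProduct xs ys) ≡ parity (λ x → parity (λ y → c (x , y)) ys) xs
parity-cartesianProduct c []       ys = refl
parity-cartesianProduct c (x ∷ xs) ys =
  trans (parity-++ c (map (x ,_) ys) (cartesianProduct xs ys))
        (cong₂ _xor_ (parity-map c (x ,_) ys) (parity-cartesianProduct c xs ys))

parity-allFin : ∀ N (c : Fin N → Bool) → parity c (allFin N) ≡ parityFin c
parity-allFin N c = trans (cong (foldr _xor_ false) (map-tabulate (λ i → i) c)) (tabulated N c)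
  where
  tabulated : ∀ N (c : Fin N → Bool) → foldr _xor_ false (tabulate c) ≡ parityFin c
  tabulated zero    c = refl
  tabulated (suc N) c = cong (c Fin.zero xor_) (tabulated N (c ∘ Fin.suc))

parityFin-δ : ∀ {N} (i : Fin N) (r : Fin N → Bool) → parityFin (λ k → does (i ≟ k) ∧ r k) ≡ r i
parityFin-δ {suc N} Fin.zero    r = trans (cong (r Fin.zero xor_) (sum-replicate-zero N)) (xor-identityʳ _)
parityFin-δ {suc N} (Fin.suc i) r = parityFin-δ i (r ∘ Fin.suc)

parityFin-δ-const : ∀ {N} (i : Fin N) → parityFin (λ k → does (i ≟ k)) ≡ true
parityFin-δ-const i = trans (sum-cong-≗ (λ k → sym (∧-identityʳ (does (i ≟ k))))) (parityFin-δ i (λ _ → true))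

odd : ℕ → Bool
odd zero    = false
odd (suc n) = not (odd n)

parityBelow : ℕ → (ℕ → Bool) → Bool
parityBelow zero    h = false
parityBelow (suc N) h = h 0 xor parityBelow N (h ∘ suc)

parityFin-toℕ : ∀ N (h : ℕ → Bool) → parityFin (λ (l : Fin N) → h (toℕ l)) ≡ parityBelow N h
parityFin-toℕ zero    h = refl
parityFin-toℕ (suc N) h = cong (h 0 xor_) (parityFin-toℕ N (h ∘ suc))

parityBelow-cong : ∀ N {g h : ℕ → Bool} → (∀ l → l < N → g l ≡ h l) → parityBelow N g ≡ parityBelow N h
parityBelow-cong zero    g≡h = refl
parityBelow-cong (suc N) g≡h =
  cong₂ _xor_ (g≡h 0 (s≤s ℕ.z≤n)) (parityBelow-cong N (λ l → g≡h (suc l) ∘ s≤s))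

parityBelow-snoc : ∀ N (h : ℕ → Bool) → parityBelow (suc N) h ≡ parityBelow N h xor h N
parityBelow-snoc zero    h = xor-comm (h 0) false
parityBelow-snoc (suc N) h =
  trans (cong (h 0 xor_) (parityBelow-snoc N (h ∘ suc))) (sym (xor-assoc (h 0) _ _))

parityBelow-shift : ∀ N (h : ℕ → Bool) → parityBelow N (h ∘ suc) ≡ h 0 xor (parityBelow N h xor h N)
parityBelow-shift N h = begin
  parityBelow N (h ∘ suc)                     ≡⟨ cong (_xor parityBelow N (h ∘ suc)) (xor-same (h 0)) ⟨
  (h 0 xor h 0) xor parityBelow N (h ∘ suc)   ≡⟨ xor-assoc (h 0) (h 0) _ ⟩
  h 0 xor parityBelow (suc N) h               ≡⟨ cong (h 0 xor_) (parityBelow-snoc N h) ⟩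
  h 0 xor (parityBelow N h xor h N)           ∎
  where open ≡-Reasoning

parityBelow-≥ : ∀ a b → parityBelow (a + b) (λ l → not (does (l <? a))) ≡ odd b
parityBelow-≥ zero    zero    = refl
parityBelow-≥ zero    (suc b) = cong not (parityBelow-≥ zero b)
parityBelow-≥ (suc a) b       = parityBelow-≥ a b

-- The index set S, through the 1-based index sum s = i + j (so s = toℕ i + toℕ j + 2)

SumInS : ℕ → ℕ → Set
SumInS n s = (n + 1 ≤ s × s ≤ 2 ℕ.* n) ⊎ (3 ℕ.* n + 2 ≤ s × s ≤ 4 ℕ.* n)

sumInS? : ∀ n s → Dec (SumInS n s)
sumInS? n s = ((n + 1 ≤? s) ×-dec (s ≤? 2 ℕ.* n)) ⊎-dec ((3 ℕ.* n + 2 ≤? s) ×-dec (s ≤? 4 ℕ.* n))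

sumInS : ℕ → ℕ → Bool
sumInS n s = does (sumInS? n s)

S? : ∀ n → Decidable (S n)
S? n (i , j) = sumInS? n (toℕ i + toℕ j + 2)

sumInS-≤ : ∀ n {s} → s ≤ n → sumInS n s ≡ false
sumInS-≤ n {s} s≤n = dec-false (sumInS? n s) λ
  { (inj₁ (n+1≤s , _)) → m+1+n≰m n (≤-trans n+1≤s s≤n)
  ; (inj₂ (3n+2≤s , _)) →
      m+1+n≰m n (≤-trans (+-mono-≤ (m≤m+n n (2 ℕ.* n)) (s≤s ℕ.z≤n)) (≤-trans 3n+2≤s s≤n)) }

sumInS-middle : ∀ n {s} → n < s → s ≤ n + n → sumInS n s ≡ true
sumInS-middle n {s} n<s s≤2n = dec-true (sumInS? n s) (inj₁
  ( ≤-trans (≤-reflexive (+-comm n 1)) n<s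
  , ≤-trans s≤2n (≤-reflexive (cong (n +_) (sym (+-identityʳ n)))) ))

sumInS-gap : ∀ n {s} → n + n < s → s < 2 + (n + (n + n)) → sumInS n s ≡ false
sumInS-gap n {s} 2n<s s<3n+2 = dec-false (sumInS? n s) λ
  { (inj₁ (_ , s≤2n)) → <⇒≱ 2n<s (≤-trans s≤2n (≤-reflexive (cong (n +_) (+-identityʳ n))))
  ; (inj₂ (3n+2≤s , _)) → <⇒≱ s<3n+2 (≤-trans (≤-reflexive (3n+2≡ n)) 3n+2≤s) }
  where
  3n+2≡ : ∀ n → 2 + (n + (n + n)) ≡ 3 ℕ.* n + 2
  3n+2≡ = solve-∀

sumInS-top : ∀ n {s} → 2 + (n + (n + n)) ≤ s → s ≤ (n + n) + (n + n) → sumInS n s ≡ true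
sumInS-top n {s} 3n+2≤s s≤4n = dec-true (sumInS? n s) (inj₂
  (≤-trans (≤-reflexive (3n+2≡ n)) 3n+2≤s , ≤-trans s≤4n (≤-reflexive (4n≡ n))))
  where
  3n+2≡ : ∀ n → 3 ℕ.* n + 2 ≡ 2 + (n + (n + n))
  3n+2≡ = solve-∀
  4n≡ : ∀ n → (n + n) + (n + n) ≡ 4 ℕ.* n
  4n≡ = solve-∀

sumInS-lower : ∀ n {t} → 2 + t ≤ n + n → sumInS n (2 + t) ≡ not (does (suc t <? n))
sumInS-lower n {t} 2+t≤2n with suc t <? n
... | yes 2+t≤n = trans (sumInS-≤ n 2+t≤n)
                      (cong not (sym (dec-true (suc t <? n) 2+t≤n)))
... | no  t+1≮n = trans (sumInS-middle n (s≤s (≮⇒≥ t+1≮n)) 2+t≤2n)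
                      (cong not (sym (dec-false (suc t <? n) t+1≮n)))

sumInS-upper : ∀ n {t} → 2 + t ≤ n + n → sumInS n (2 + (t + (n + n))) ≡ not (does (t <? n))
sumInS-upper n {t} 2+t≤2n with t <? n
... | yes t<n = trans (sumInS-gap n (s≤s (m≤n⇒m≤1+n (m≤n+m (n + n) t)))
                                   (+-monoʳ-≤ 2 (+-monoˡ-≤ (n + n) t<n)))
                    (cong not (sym (dec-true (t <? n) t<n)))
... | no  t≮n = trans (sumInS-top n (+-monoʳ-≤ 2 (+-monoˡ-≤ (n + n) (≮⇒≥ t≮n)))
                                   (+-monoˡ-≤ (n + n) 2+t≤2n))
                    (cong not (sym (dec-false (t <? n) t≮n)))

-- the parity of row i (0-based) of S, whose entries have the index sums 2 + i + l, l < 2n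
window : ℕ → ℕ → Bool
window n i = parityBelow (n + n) (λ l → sumInS n (2 + (i + l)))

window-zero : ∀ m → window (suc m) 0 ≡ odd (suc m)
window-zero m = begin
  window n 0                                                   ≡⟨ parityBelow-snoc (m + n) h ⟩
  parityBelow (m + n) h xor h (m + n)                          ≡⟨ cong₂ _xor_ threshold last ⟩
  parityBelow (m + n) (λ l → not (does (l <? m))) xor false    ≡⟨ xor-identityʳ _ ⟩
  parityBelow (m + n) (λ l → not (does (l <? m)))              ≡⟨ parityBelow-≥ m n ⟩
  odd n                                                        ∎
  where
  open ≡-Reasoning
  n = suc m
  h : ℕ → Bool
  h l = sumInS n (2 + l)
  threshold : parityBelow (m + n) h ≡ parityBelow (m + n) (λ l → not (does (l <? m)))
  threshold = parityBelow-cong (m + n) (λ l l<m+n → sumInS-lower n (s≤s l<m+n))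
  last : h (m + n) ≡ false
  last = sumInS-gap n (n<1+n _) (s≤s (s≤s (s≤s (+-monoʳ-≤ m (m≤n+m n n)))))

window-closed : ∀ n i → i < n + n → window n i ≡ not (does (i <? n)) xor odd n
window-closed (suc m) zero    _    = window-zero m
window-closed n       (suc i) i<2n = begin
  window n (suc i)
    ≡⟨ parityBelow-cong (n + n) (λ l _ → cong (sumInS n ∘ (2 +_)) (sym (+-suc i l))) ⟩
  parityBelow (n + n) (h ∘ suc)
    ≡⟨ parityBelow-shift (n + n) h ⟩
  h 0 xor (window n i xor h (n + n))
    ≡⟨ cong₂ _xor_ leaving (cong₂ _xor_ (window-closed n i (<-trans (n<1+n i) i<2n)) (sumInS-upper n i<2n)) ⟩
  y xor ((x xor odd n) xor x)
    ≡⟨ cong (y xor_) (xor-cancel-outer x (odd n)) ⟩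
  y xor odd n
    ∎
  where
  open ≡-Reasoning
  h : ℕ → Bool
  h l = sumInS n (2 + (i + l))
  x = not (does (i <? n))
  y = not (does (suc i <? n))
  leaving : h 0 ≡ y
  leaving = trans (cong (sumInS n ∘ (2 +_)) (+-identityʳ i)) (sumInS-lower n i<2n)

rowParity : ∀ n → Fin (n + n) → Bool
rowParity n i = parityFin (λ l → does (S? n (i , l)))

rowParity-closed : ∀ n (i : Fin (n + n)) → rowParity n i ≡ not (does (toℕ i <? n)) xor odd n
rowParity-closed n i = begin
  rowParity n i
    ≡⟨⟩
  parityFin {n + n} (λ l → sumInS n (toℕ i + toℕ l + 2))
    ≡⟨ sum-cong-≗ {n + n} (λ l → cong (sumInS n) (+-comm (toℕ i + toℕ l) 2)) ⟩
  parityFin {n + n} (λ l → sumInS n (2 + (toℕ i + toℕ l)))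
    ≡⟨ parityFin-toℕ (n + n) (λ l → sumInS n (2 + (toℕ i + l))) ⟩
  window n (toℕ i)
    ≡⟨ window-closed n (toℕ i) (toℕ<n i) ⟩
  not (does (toℕ i <? n)) xor odd n
    ∎
  where open ≡-Reasoning

allPairs : ∀ N → List (Fin N × Fin N)
allPairs N = cartesianProduct (allFin N) (allFin N)

enumS : ∀ n → List (Fin (n + n) × Fin (n + n))
enumS n = filter (S? n) (allPairs (n + n))

enumS-unique : ∀ n → Unique (enumS n)
enumS-unique n = Unique.filter⁺ (S? n) (Unique.cartesianProduct⁺ (Unique.allFin⁺ _) (Unique.allFin⁺ _))

∈enumS⇔S : ∀ n p → p ∈ enumS n ⇔ S n p
∈enumS⇔S n (i , j) = mk⇔ (proj₂ ∘ ∈-filter⁻ (S? n) {xs = allPairs (n + n)})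
                          (∈-filter⁺ (S? n) (∈-cartesianProduct⁺ (∈-allFin i) (∈-allFin j)))

↭enumS : ∀ n (L : List (Fin (n + n) × Fin (n + n))) → Unique L → (∀ p → p ∈ L ⇔ S n p) → L ↭ enumS n
↭enumS n L unique-L ∈L⇔S = ∼bag⇒↭ (unique∧set⇒bag unique-L (enumS-unique n) (λ {p} → mk⇔
  (Equivalence.from (∈enumS⇔S n p) ∘ Equivalence.to (∈L⇔S p))
  (Equivalence.from (∈L⇔S p) ∘ Equivalence.to (∈enumS⇔S n p))))

hits : ∀ {N} → Fin N → Fin N → Fin N × Fin N → Bool
hits i j (k , l) = does (i ≟ k) xor does (j ≟ l)

parity-filter-allPairs : ∀ {N p} {P : Fin N × Fin N → Set p} (P? : Decidable P) (c : Fin N × Fin N → Bool) →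
  parity c (filter P? (allPairs N)) ≡ parityFin (λ k → parityFin (λ l → does (P? (k , l)) ∧ c (k , l)))
parity-filter-allPairs {N} P? c = begin
  parity c (filter P? (allPairs N))
    ≡⟨ parity-filter P? c (allPairs N) ⟩
  parity c′ (allPairs N)
    ≡⟨ parity-cartesianProduct c′ (allFin N) (allFin N) ⟩
  parity (λ k → parity (c′ ∘ (k ,_)) (allFin N)) (allFin N)
    ≡⟨ parity-allFin N (λ k → parity (c′ ∘ (k ,_)) (allFin N)) ⟩
  parityFin (λ k → parity (c′ ∘ (k ,_)) (allFin N))
    ≡⟨ sum-cong-≗ (λ k → parity-allFin N (c′ ∘ (k ,_))) ⟩
  parityFin (λ k → parityFin (c′ ∘ (k ,_)))
    ∎
  where
  open ≡-Reasoning
  c′ : Fin N × Fin N → Bool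
  c′ p = does (P? p) ∧ c p

parity-hits-enumS : ∀ n (i j : Fin (n + n)) → parity (hits i j) (enumS n) ≡ rowParity n i xor rowParity n j
parity-hits-enumS n i j = begin
  parity (hits i j) (enumS n)                                ≡⟨ parity-filter-allPairs (S? n) (hits i j) ⟩
  parityFin (λ k → parityFin (λ l → s k l ∧ hits i j (k , l))) ≡⟨ sum-cong-≗ split ⟩
  parityFin (λ k → rowPart k xor columnPart k)               ≡⟨ ∑-distrib-+ rowPart columnPart ⟩
  parityFin rowPart xor parityFin columnPart                 ≡⟨ cong₂ _xor_ row column ⟩
  rowParity n i xor rowParity n j                            ∎
  where
  open ≡-Reasoning
  N = n + n
  s : Fin N → Fin N → Bool
  s k l = does (S? n (k , l))
  rowPart columnPart : Fin N → Bool
  rowPart    k = parityFin (λ l → s k l ∧ does (i ≟ k))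
  columnPart k = parityFin (λ l → s k l ∧ does (j ≟ l))
  split : ∀ k → parityFin (λ l → s k l ∧ hits i j (k , l)) ≡ rowPart k xor columnPart k
  split k = trans (sum-cong-≗ (λ l → ∧-distribˡ-xor (s k l) (does (i ≟ k)) (does (j ≟ l))))
                  (∑-distrib-+ (λ l → s k l ∧ does (i ≟ k)) (λ l → s k l ∧ does (j ≟ l)))
  row : parityFin rowPart ≡ rowParity n i
  row = trans (sum-cong-≗ (λ k → trans (sum-cong-≗ (λ l → ∧-comm (s k l) (does (i ≟ k))))
                                       (sym (*-distribˡ-sum (does (i ≟ k)) (s k)))))
              (parityFin-δ i (rowParity n))
  S-symmetric : ∀ k → s k j ≡ s j k
  S-symmetric k = cong (λ t → sumInS n (t + 2)) (+-comm (toℕ k) (toℕ j))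
  column : parityFin columnPart ≡ rowParity n j
  column = sum-cong-≗ (λ k → trans (sum-cong-≗ (λ l → ∧-comm (s k l) (does (j ≟ l))))
                                   (trans (parityFin-δ j (s k)) (S-symmetric k)))

parity-hits-S : ∀ n (i j : Fin (n + n)) (L : List (Fin (n + n) × Fin (n + n))) →
  Unique L → (∀ p → p ∈ L ⇔ S n p) → parity (hits i j) L ≡ does (toℕ i <? n) xor does (toℕ j <? n)
parity-hits-S n i j L unique-L ∈L⇔S = begin
  parity (hits i j) L                      ≡⟨ parity-↭ (hits i j) (↭enumS n L unique-L ∈L⇔S) ⟩
  parity (hits i j) (enumS n)              ≡⟨ parity-hits-enumS n i j ⟩
  rowParity n i xor rowParity n j          ≡⟨ cong₂ _xor_ (rowParity-closed n i) (rowParity-closed n j) ⟩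
  (not a xor odd n) xor (not b xor odd n)  ≡⟨ xor-cancelʳ-both (not a) (not b) (odd n) ⟩
  not a xor not b                          ≡⟨ xor-annihilates-not a b ⟩
  a xor b                                  ∎
  where
  open ≡-Reasoning
  a = does (toℕ i <? n)
  b = does (toℕ j <? n)

-- Permutations

and-true : ∀ {b} bs → foldr _∧_ true bs ≡ true → b ∈ bs → b ≡ true
and-true (true ∷ bs) _     (here b≡true) = b≡true
and-true (true ∷ bs) and≡t (there b∈bs)  = and-true bs and≡t b∈bs
and-true (false ∷ bs) ()   _

perms-injective : ∀ {N} {π : Fin N → Fin N} → π ∈ perms N → Injective _≡_ _≡_ π
perms-injective {N} {π} π∈perms {i} {j} πi≡πj with π i ≟ π j | i ≟ j | test-passes
  where
  test : Fin N → Fin N → Bool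
  test i j = if does (π i ≟ π j) then does (i ≟ j) else true
  test-passes : test i j ≡ true
  test-passes = and-true _ (proj₂ (∈-filter⁻ (λ f → isInjective f Bool.≟ true) {xs = allFuns N N} π∈perms))
    (∈-concat⁺′ (∈-map⁺ (test i) (∈-allFin j)) (∈-map⁺ (λ i → map (test i) (allFin N)) (∈-allFin i)))
... | _         | yes i≡j | _  = i≡j
... | yes _     | no  _   | ()
... | no πi≢πj  | no  _   | _  = ⊥-elim (πi≢πj πi≡πj)

injective⇒surjective : ∀ {N} {π : Fin N → Fin N} → Injective _≡_ _≡_ π → ∀ l → ∃ λ i → π i ≡ l
injective⇒surjective {suc N} {π} π-inj l with any? (λ i → π i ≟ l)
... | yes found = found
... | no  l∉im = ⊥-elim (<-irrefl refl (injective⇒≤ {f = π∖l} π∖l-injective))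
  where
  l≢π : ∀ i → l ≢ π i
  l≢π i l≡πi = l∉im (i , sym l≡πi)
  π∖l : Fin (suc N) → Fin N
  π∖l i = punchOut (l≢π i)
  π∖l-injective : Injective _≡_ _≡_ π∖l
  π∖l-injective eq = π-inj (punchOut-injective (l≢π _) (l≢π _) eq)

parityFin-preimage : ∀ {N} {π : Fin N → Fin N} → Injective _≡_ _≡_ π → ∀ l →
                     parityFin (λ i → does (π i ≟ l)) ≡ true
parityFin-preimage {π = π} π-inj l with injective⇒surjective π-inj l
... | i₀ , πi₀≡l = trans (sum-cong-≗ at-i₀) (parityFin-δ-const i₀)
  where
  at-i₀ : ∀ i → does (π i ≟ l) ≡ does (i₀ ≟ i)
  at-i₀ i with π i ≟ l | i₀ ≟ i
  ... | yes _      | yes _      = refl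
  ... | no  _      | no  _      = refl
  ... | yes πi≡l   | no  i₀≢i   = ⊥-elim (i₀≢i (π-inj (trans πi₀≡l (sym πi≡l))))
  ... | no  πi≢l   | yes i₀≡i   = ⊥-elim (πi≢l (trans (cong π (sym i₀≡i)) πi₀≡l))

parity-flips-permutation : ∀ {N} (k l : Fin N) {π : Fin N → Fin N} → Injective _≡_ _≡_ π →
                           parity (λ i → does (i ≟ k) xor does (π i ≟ l)) (allFin N) ≡ false
parity-flips-permutation {N} k l {π} π-inj =
  trans (parity-allFin N _) (trans (∑-distrib-+ (λ i → does (i ≟ k)) (λ i → does (π i ≟ l)))
  (cong₂ _xor_ (parityFin-preimage {π = λ i → i} (λ i≡j → i≡j) k) (parityFin-preimage π-inj l)))

-- Signs and permanents over a commutative ring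

module _ {c ℓ} (R : CommutativeRing c ℓ) where
  open CommutativeRing R hiding (_+_) renaming (refl to ≈-refl; sym to ≈-sym; trans to ≈-trans)
  open RingProperties ring using (-‿involutive; -‿distribˡ-*; -‿distribʳ-*)
  open import Relation.Binary.Reasoning.Setoid setoid

  negIf-cong : ∀ b {x y} → x ≈ y → negIf R b x ≈ negIf R b y
  negIf-cong true  x≈y = -‿cong x≈y
  negIf-cong false x≈y = x≈y

  negIf-negIf : ∀ a b x → negIf R a (negIf R b x) ≈ negIf R (a xor b) x
  negIf-negIf true  true  x = -‿involutive x
  negIf-negIf true  false x = ≈-refl
  negIf-negIf false b     x = ≈-refl

  negIf-*-negIf : ∀ a b x y → negIf R a x * negIf R b y ≈ negIf R (a xor b) (x * y)
  negIf-*-negIf true true x y = begin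
    - x * - y      ≈⟨ -‿distribˡ-* x (- y) ⟨
    - (x * - y)    ≈⟨ -‿cong (-‿distribʳ-* x y) ⟨
    - - (x * y)    ≈⟨ -‿involutive _ ⟩
    x * y          ∎
  negIf-*-negIf true  false x y = ≈-sym (-‿distribˡ-* x y)
  negIf-*-negIf false true  x y = ≈-sym (-‿distribʳ-* x y)
  negIf-*-negIf false false x y = ≈-refl

  negIf≈*sign : ∀ b x → negIf R b x ≈ x * (if b then - 1# else 1#)
  negIf≈*sign true  x = ≈-trans (-‿cong (≈-sym (*-identityʳ x))) (-‿distribʳ-* x 1#)
  negIf≈*sign false x = ≈-sym (*-identityʳ x)

  applyAll≈negIf : ∀ {N} (L : List (Fin N × Fin N)) (A : Matrix R N) i j →
                   applyAll R L A i j ≈ negIf R (parity (hits i j) L) (A i j)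
  applyAll≈negIf []             A i j = ≈-refl
  applyAll≈negIf ((k , l) ∷ L) A i j = begin
    negIf R rᵢ (negIf R cⱼ (applyAll R L A i j))
      ≈⟨ negIf-cong rᵢ (negIf-cong cⱼ (applyAll≈negIf L A i j)) ⟩
    negIf R rᵢ (negIf R cⱼ (negIf R p (A i j)))
      ≈⟨ negIf-cong rᵢ (negIf-negIf cⱼ p _) ⟩
    negIf R rᵢ (negIf R (cⱼ xor p) (A i j))
      ≈⟨ negIf-negIf rᵢ _ _ ⟩
    negIf R (rᵢ xor (cⱼ xor p)) (A i j)
      ≡⟨ cong (λ z → negIf R z (A i j)) (sym (xor-assoc rᵢ cⱼ p)) ⟩
    negIf R ((rᵢ xor cⱼ) xor p) (A i j)
      ∎
    where
    rᵢ = does (i ≟ k)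
    cⱼ = does (j ≟ l)
    p = parity (hits i j) L

  applyAll-S≋∘Ũ : ∀ n (A : Matrix R (n + n)) (L : List (Fin (n + n) × Fin (n + n))) →
                  Unique L → (∀ p → p ∈ L ⇔ S n p) → _≋_ R (applyAll R L A) (_∘ₕ_ R A (Ũ R n))
  applyAll-S≋∘Ũ n A L unique-L ∈L⇔S i j = begin
    applyAll R L A i j
      ≈⟨ applyAll≈negIf L A i j ⟩
    negIf R (parity (hits i j) L) (A i j)
      ≡⟨ cong (λ z → negIf R z (A i j)) (parity-hits-S n i j L unique-L ∈L⇔S) ⟩
    negIf R (does (toℕ i <? n) xor does (toℕ j <? n)) (A i j)
      ≈⟨ negIf≈*sign _ (A i j) ⟩
    A i j * Ũ R n i j
      ∎

  product-negIf : ∀ {N} (xs : List (Fin N)) (b : Fin N → Bool) (x : Fin N → Carrier) →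
    foldr _*_ 1# (map (λ i → negIf R (b i) (x i)) xs) ≈ negIf R (parity b xs) (foldr _*_ 1# (map x xs))
  product-negIf []       b x = ≈-refl
  product-negIf (i ∷ xs) b x = ≈-trans (*-congˡ (product-negIf xs b x)) (negIf-*-negIf (b i) (parity b xs) (x i) _)

  prodFin-cong : ∀ {N} {f g : Fin N → Carrier} → (∀ i → f i ≈ g i) → prodFin R N f ≈ prodFin R N g
  prodFin-cong {N} f≈g = go (allFin N)
    where
    go : ∀ xs → foldr _*_ 1# (map _ xs) ≈ foldr _*_ 1# (map _ xs)
    go []       = ≈-refl
    go (i ∷ xs) = *-cong (f≈g i) (go xs)

  sumL-cong-∈ : ∀ {a} {X : Set a} (xs : List X) {f g : X → Carrier} →
                (∀ x → x ∈ xs → f x ≈ g x) → sumL R (map f xs) ≈ sumL R (map g xs)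
  sumL-cong-∈ []       f≈g = ≈-refl
  sumL-cong-∈ (x ∷ xs) f≈g = +-cong (f≈g x (here refl)) (sumL-cong-∈ xs (λ y → f≈g y ∘ there))

  per-cong : ∀ {N} {A B : Matrix R N} → _≋_ R A B → per R A ≈ per R B
  per-cong {N} A≋B = sumL-cong-∈ (perms N) (λ π _ → prodFin-cong (λ i → A≋B i (π i)))

  per-φ : ∀ {N} (k l : Fin N) (B : Matrix R N) → per R (φ R k l B) ≈ per R B
  per-φ {N} k l B = sumL-cong-∈ (perms N) λ π π∈perms → begin
    prodFin R N (λ i → φ R k l B i (π i))
      ≈⟨ prodFin-cong (λ i → negIf-negIf (does (i ≟ k)) (does (π i ≟ l)) _) ⟩
    prodFin R N (λ i → negIf R (flip π i) (B i (π i)))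
      ≈⟨ product-negIf (allFin N) (flip π) _ ⟩
    negIf R (parity (flip π) (allFin N)) (prodFin R N (λ i → B i (π i)))
      ≡⟨ cong (λ z → negIf R z (prodFin R N (λ i → B i (π i))))
              (parity-flips-permutation k l (perms-injective π∈perms)) ⟩
    prodFin R N (λ i → B i (π i))
      ∎
    where
    flip : (Fin N → Fin N) → Fin N → Bool
    flip π i = does (i ≟ k) xor does (π i ≟ l)

  per-applyAll : ∀ {N} (L : List (Fin N × Fin N)) (A : Matrix R N) → per R (applyAll R L A) ≈ per R A
  per-applyAll []             A = ≈-refl
  per-applyAll ((k , l) ∷ L) A = ≈-trans (per-φ k l (applyAll R L A)) (per-applyAll L A)

lemma3p9 : ∀ {c ℓ} (R : CommutativeRing c ℓ) (n : ℕ) (A : Matrix R (n + n))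
           → ((L : List (Fin (n + n) × Fin (n + n)))
              → Unique L
              → (∀ p → (p ∈ L) ⇔ S n p)
              → _≋_ R (applyAll R L A) (_∘ₕ_ R A (Ũ R n)))
             × CommutativeRing._≈_ R (per R A) (per R (_∘ₕ_ R A (Ũ R n)))
lemma3p9 R n A =
    applyAll-S≋∘Ũ R n A
  , CommutativeRing.trans R (CommutativeRing.sym R (per-applyAll R (enumS n) A))
      (per-cong R (applyAll-S≋∘Ũ R n A (enumS n) (enumS-unique n) (∈enumS⇔S n)))
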